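{- Let $n\geq 600$ and let $G$ be a graph on $2n+1$ vertices with at least $n^2+n$ edges, such that $G$ contains no two vertices of the same degree joined by a path of length three, and $G$ is not $K_{n,n+1}$. Let $v\in V(G)$. If a vertex $u\in N(v)$ has at least two neighbours in $N(v)$, then $d(u)\neq d(w)$ for every $w\in N(v)\setminus\{u\}$.
   Context: Graphs are finite and simple. $N(x)$ is the set of neighbours of $x$ and $d(x)=|N(x)|$. A path of length three is a path with three edges on four distinct vertices; its endpoints are said to be joined by it. -}

module Defs where

open import Data.Nat using (ℕ; _<_)
open import Data.Bool using (Bool; true; false)
open import Data.Fin using (Fin; toℕ)
open import Data.List using (List; length; filter; allFin; cartesianProduct)
open import Data.Product using (_×_; _,_; Σ; ∃; ∃-syntax)
open import Relation.Binary.PropositionalEquality using (_≡_; _≢_)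
open import Relation.Nullary using (¬_)
open import Data.Nat.Properties using (_<?_)
open import Data.Bool.Properties using () renaming (_≟_ to _≟b_)
open import Function using (_∘_)

record Graph (m : ℕ) : Set where
  field
    adj   : Fin m → Fin m → Bool
    sym   : ∀ x y → adj x y ≡ adj y x
    irrefl : ∀ x → adj x x ≡ false
open Graph public

Adj : ∀ {m} → Graph m → Fin m → Fin m → Set
Adj G x y = adj G x y ≡ true

degree : ∀ {m} → Graph m → Fin m → ℕ
degree G x = length (filter (λ y → adj G x y ≟b true) (allFin _))

edgeCount : ∀ {m} → Graph m → ℕ
edgeCount {m} G =
  length (filter (λ p → adj G (Data.Product.proj₁ p) (Data.Product.proj₂ p) ≟b true)
           (filter (λ p → toℕ (Data.Product.proj₁ p) <? toℕ (Data.Product.proj₂ p))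
             (cartesianProduct (allFin m) (allFin m))))

P3Joined : ∀ {m} → Graph m → Fin m → Fin m → Set
P3Joined G x y = ∃[ b ] ∃[ c ]
  ( x ≢ b × x ≢ c × x ≢ y × b ≢ c × b ≢ y × c ≢ y
  × Adj G x b × Adj G b c × Adj G c y )

NoEqualDegreeP3 : ∀ {m} → Graph m → Set
NoEqualDegreeP3 G = ∀ x y → degree G x ≡ degree G y → ¬ P3Joined G x y

-- G is (isomorphic to) the complete bipartite graph K_{a,b}: there is a
-- 2-colouring `side` with exactly a vertices on side true (hence the
-- remaining b = m - a on side false) such that x ~ y iff sides differ.
IsK : ∀ {m} → ℕ → ℕ → Graph m → Set
IsK {m} a b G = Σ (Fin m → Bool) λ side →
    length (filter (λ x → side x ≟b true) (allFin m)) ≡ a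
  × length (filter (λ x → side x ≟b false) (allFin m)) ≡ b
  × (∀ x y → (Adj G x y → side x ≢ side y) × (side x ≢ side y → Adj G x y))

-- Two common neighbours of u and v cannot both be w, so some common neighbour b differs
-- from w, and then u - b - v - w is a path of length three joining u and w.
module Submission where

open import Defs
open import Data.Nat using (ℕ; suc; _+_; _*_; _≥_)
open import Data.Fin using (Fin)
open import Data.Fin.Properties using (_≟_)
open import Data.Product using (_×_; _,_; ∃-syntax)
open import Relation.Binary.PropositionalEquality using (_≢_; refl; trans; ≢-sym) renaming (sym to ≡-sym)
open import Relation.Nullary using (¬_; yes; no)

module _ {m : ℕ} (G : Graph m) where

  Adj-sym : ∀ {x y} → Adj G x y → Adj G y x
  Adj-sym {x} {y} xy = trans (Graph.sym G y x) xy

  Adj⇒≢ : ∀ {x y} → Adj G x y → x ≢ y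
  Adj⇒≢ {x} xx refl with trans (≡-sym xx) (irrefl G x)
  ... | ()

  triangle-edge⇒P3Joined : ∀ {u b v w} → Adj G u b → Adj G b v → Adj G v u → Adj G v w
    → b ≢ w → u ≢ w → P3Joined G u w
  triangle-edge⇒P3Joined {b = b} {v} ub bv vu vw b≢w u≢w =
    b , v , Adj⇒≢ ub , ≢-sym (Adj⇒≢ vu) , u≢w , Adj⇒≢ bv , b≢w , Adj⇒≢ vw , ub , bv , vw

  common-neighbour-avoiding : ∀ {u v} w
    → (∃[ w₁ ] ∃[ w₂ ] (w₁ ≢ w₂ × Adj G v w₁ × Adj G v w₂ × Adj G u w₁ × Adj G u w₂))
    → ∃[ b ] (b ≢ w × Adj G v b × Adj G u b)
  common-neighbour-avoiding w (w₁ , w₂ , w₁≢w₂ , vw₁ , vw₂ , uw₁ , uw₂) with w₁ ≟ w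
  ... | no w₁≢w  = w₁ , w₁≢w , vw₁ , uw₁
  ... | yes refl = w₂ , ≢-sym w₁≢w₂ , vw₂ , uw₂

lemma2p1 : (n : ℕ) → n ≥ 600 → (G : Graph (suc (2 * n)))
    → edgeCount G ≥ n * n + n
    → NoEqualDegreeP3 G
    → ¬ IsK n (suc n) G
    → (v u : Fin (suc (2 * n))) → Adj G v u
    → (∃[ w₁ ] ∃[ w₂ ] (w₁ ≢ w₂ × Adj G v w₁ × Adj G v w₂ × Adj G u w₁ × Adj G u w₂))
    → (w : Fin (suc (2 * n))) → Adj G v w → w ≢ u → degree G u ≢ degree G w
lemma2p1 n _ G _ noEqualDegreeP3 _ v u vu commonNeighbours w vw w≢u du≡dw
  with common-neighbour-avoiding G w commonNeighbours
... | b , b≢w , vb , ub =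
  noEqualDegreeP3 u w du≡dw
    (triangle-edge⇒P3Joined G ub (Adj-sym G vb) vu vw b≢w (≢-sym w≢u))
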